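{- Let $\mathscr{U}=(U,\mathcal{A},\lambda)$ be a linear reflexive object in a Cartesian closed differential category which is extensional, i.e. additionally $\lambda\circ\mathcal{A}=\mathrm{Id}_U$. Then $\mathrm{Th}(\mathscr{U})$ is extensional: for every simple term $s$ and variable $x\notin\mathrm{FV}(s)$, the equation $\lambda x.sx=s$ belongs to $\mathrm{Th}(\mathscr{U})$.
   Context: Cartesian closed differential category: a category with commutative-monoid homsets $(+,0)$ satisfying $(g+h)\circ f=g\circ f+h\circ f$, $0\circ f=0$, with finite products whose projections are additive and pairings of additive maps additive, with an operator $D$ sending $f:A\to B$ to $D(f):A\times A\to B$ satisfying the Cartesian differential category axioms (D1)–(D7) [(D1) $D(f+g)=D(f)+D(g)$, $D(0)=0$; (D2) $D(f)\circ\langle h+k,v\rangle=D(f)\circ\langle h,v\rangle+D(f)\circ\langle k,v\rangle$, $D(f)\circ\langle0,v\rangle=0$; (D3) $D(\mathrm{Id})=\pi_1$, $D(\pi_1)=\pi_1\circ\pi_1$, $D(\pi_2)=\pi_2\circ\pi_1$; (D4) $D\langle f,g\rangle=\langle Df,Dg\rangle$; (D5) $D(f\circ g)=D(f)\circ\langle D(g),g\circ\pi_2\rangle$; (D6) $D(D(f))\circ\langle\langle g,0\rangle,\langle h,k\rangle\rangle=D(f)\circ\langle g,k\rangle$; (D7) $D(D(f))\circ\langle\langle0,h\rangle,\langle g,k\rangle\rangle=D(D(f))\circ\langle\langle0,g\rangle,\langle h,k\rangle\rangle$], Cartesian closed with $\Lambda(f+g)=\Lambda f+\Lambda g$, $\Lambda(0)=0$,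 $D(\Lambda f)=\Lambda(D(f)\circ\langle\pi_1\times0_A,\pi_2\times\mathrm{Id}_A\rangle)$. $\Lambda^-(h)=\mathrm{ev}\circ(h\times\mathrm{Id})$; $f$ linear iff $D(f)=f\circ\pi_1$; $f\star g=D(f)\circ\langle\langle0_C,g\circ\pi_1\rangle,\mathrm{Id}_{C\times A}\rangle$ for $f:C\times A\to B,g:C\to A$. Linear reflexive object: $\mathcal{A}:U\to[U\Rightarrow U]$, $\lambda:[U\Rightarrow U]\to U$ linear with $\mathcal{A}\circ\lambda=\mathrm{Id}$. Differential $\lambda$-terms $S::=0\mid s\mid s+S$, simple terms $s,t::=x\mid\lambda x.s\mid sT\mid\mathsf{D}s\cdot t$ (modulo $\alpha$, AC of $+$ with unit $0$, permutation of arguments of iterated $\mathsf{D}$). Interpretation $[\![S]\!]_{\vec x}:U^{\vec x}\to U$ for $\vec x$ a sequence of distinct variables containing $\mathrm{FV}(S)$, where $U^{x_1..x_n}=U^{x_1..x_{n-1}}\times U$: $[\![x_i]\!]=\pi_i$; $[\![sT]\!]=\mathrm{ev}\circ\langle\mathcal{A}\circ[\![s]\!],[\![T]\!]\rangle$; $[\![\lambda z.s]\!]_{\vec x}=\lambda\circ\Lambda([\![s]\!]_{\vec x,z})$; $[\![\mathsf{D}^1s\cdot t]\!]=\lambda\circ\Lambda(\Lambda^-(\mathcal{A}\circ[\![s]\!])\star[\![t]\!])$; $[\![\mathsf{D}^{n+1}s\cdot(t_1..t_{n+1})]\!]=\lambda\circ\Lambda(\Lambda^-(\mathcal{A}\circ[\![\mathsf{D}^ns\cdot(t_1..t_n)]\!])\star[\![t_{n+1}]\!])$;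 $[\![0]\!]=0$; $[\![s+S]\!]=[\![s]\!]+[\![S]\!]$. $\mathrm{Th}(\mathscr{U})=\{S=T\mid[\![S]\!]_{\vec x}=[\![T]\!]_{\vec x}\text{ for some adequate }\vec x\}$. -}

module Defs where

open import Level using (Level; _⊔_)
open import Relation.Binary using (IsEquivalence)
open import Relation.Binary.PropositionalEquality using (_≡_)
open import Data.Nat using (ℕ; _≟_)
open import Data.List using (List; []; _∷_)
open import Data.List.Membership.Propositional using (_∈_)
open import Data.List.Relation.Unary.Unique.Propositional using (Unique)
open import Data.Product using (Σ; ∃-syntax) renaming (_×_ to _∧_)
open import Relation.Nullary using (¬_; yes; no)

record Cat (o ℓ e : Level) : Set (Level.suc (o ⊔ ℓ ⊔ e)) where
  infixr 9 _∘_
  infixl 6 _+_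
  infix  4 _≈_
  infixr 7 _×ᶜ_
  field
    Obj  : Set o
    Hom  : Obj → Obj → Set ℓ
    _≈_  : ∀ {A B} → Hom A B → Hom A B → Set e
    ≈-equiv : ∀ {A B} → IsEquivalence (_≈_ {A} {B})
    id   : ∀ {A} → Hom A A
    _∘_  : ∀ {A B C} → Hom B C → Hom A B → Hom A C
    assoc : ∀ {A B C D} {f : Hom A B} {g : Hom B C} {h : Hom C D} →
            (h ∘ g) ∘ f ≈ h ∘ (g ∘ f)
    identityˡ : ∀ {A B} {f : Hom A B} → id ∘ f ≈ f
    identityʳ : ∀ {A B} {f : Hom A B} → f ∘ id ≈ f
    ∘-resp-≈  : ∀ {A B C} {f f′ : Hom B C} {g g′ : Hom A B} →
                f ≈ f′ → g ≈ g′ → f ∘ g ≈ f′ ∘ g′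
    _+_  : ∀ {A B} → Hom A B → Hom A B → Hom A B
    0h   : ∀ {A B} → Hom A B
    +-assoc : ∀ {A B} {f g h : Hom A B} → (f + g) + h ≈ f + (g + h)
    +-comm  : ∀ {A B} {f g : Hom A B} → f + g ≈ g + f
    +-identityˡ : ∀ {A B} {f : Hom A B} → 0h + f ≈ f
    +-resp-≈ : ∀ {A B} {f f′ g g′ : Hom A B} → f ≈ f′ → g ≈ g′ → f + g ≈ f′ + g′
    +-∘ : ∀ {A B C} {g h : Hom B C} {f : Hom A B} → (g + h) ∘ f ≈ g ∘ f + h ∘ f
    0-∘ : ∀ {A B C} {f : Hom A B} → (0h {B} {C}) ∘ f ≈ 0h
    ⊤ᶜ : Obj
    !  : ∀ {A} → Hom A ⊤ᶜ
    !-unique : ∀ {A} (f : Hom A ⊤ᶜ) → f ≈ !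
    _×ᶜ_ : Obj → Obj → Obj
    π₁ : ∀ {A B} → Hom (A ×ᶜ B) A
    π₂ : ∀ {A B} → Hom (A ×ᶜ B) B
    ⟨_,_⟩ : ∀ {C A B} → Hom C A → Hom C B → Hom C (A ×ᶜ B)
    π₁-β : ∀ {C A B} {f : Hom C A} {g : Hom C B} → π₁ ∘ ⟨ f , g ⟩ ≈ f
    π₂-β : ∀ {C A B} {f : Hom C A} {g : Hom C B} → π₂ ∘ ⟨ f , g ⟩ ≈ g
    ×-η  : ∀ {C A B} {h : Hom C (A ×ᶜ B)} → ⟨ π₁ ∘ h , π₂ ∘ h ⟩ ≈ h
    ⟨⟩-resp-≈ : ∀ {C A B} {f f′ : Hom C A} {g g′ : Hom C B} →
                f ≈ f′ → g ≈ g′ → ⟨ f , g ⟩ ≈ ⟨ f′ , g′ ⟩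
    [_⇒_] : Obj → Obj → Obj
    ev : ∀ {A B} → Hom ([ A ⇒ B ] ×ᶜ A) B
    Λ  : ∀ {C A B} → Hom (C ×ᶜ A) B → Hom C [ A ⇒ B ]
    Λ-resp-≈ : ∀ {C A B} {f f′ : Hom (C ×ᶜ A) B} → f ≈ f′ → Λ f ≈ Λ f′

  infixr 8 _⁂_
  _⁂_ : ∀ {A B C D} → Hom A B → Hom C D → Hom (A ×ᶜ C) (B ×ᶜ D)
  f ⁂ g = ⟨ f ∘ π₁ , g ∘ π₂ ⟩

  Λ⁻ : ∀ {C A B} → Hom C [ A ⇒ B ] → Hom (C ×ᶜ A) B
  Λ⁻ h = ev ∘ (h ⁂ id)

  IsAdditive : ∀ {A B} → Hom A B → Set (o ⊔ ℓ ⊔ e)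
  IsAdditive {A} {B} h =
    (∀ {X} (f g : Hom X A) → h ∘ (f + g) ≈ h ∘ f + h ∘ g) ∧
    (∀ {X} → h ∘ 0h {X} {A} ≈ 0h)

record IsCCDC {o ℓ e} (𝒞 : Cat o ℓ e) : Set (Level.suc (o ⊔ ℓ ⊔ e)) where
  open Cat 𝒞
  field
    π₁-additive : ∀ {A B} → IsAdditive (π₁ {A} {B})
    π₂-additive : ∀ {A B} → IsAdditive (π₂ {A} {B})
    ⟨⟩-additive : ∀ {C A B} {f : Hom C A} {g : Hom C B} →
                  IsAdditive f → IsAdditive g → IsAdditive ⟨ f , g ⟩
    Λ-β : ∀ {C A B} {f : Hom (C ×ᶜ A) B} → ev ∘ (Λ f ⁂ id) ≈ f
    Λ-η : ∀ {C A B} {h : Hom C [ A ⇒ B ]} → Λ (ev ∘ (h ⁂ id)) ≈ h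
    D : ∀ {A B} → Hom A B → Hom (A ×ᶜ A) B
    D-resp-≈ : ∀ {A B} {f g : Hom A B} → f ≈ g → D f ≈ D g
    D1-+ : ∀ {A B} {f g : Hom A B} → D (f + g) ≈ D f + D g
    D1-0 : ∀ {A B} → D (0h {A} {B}) ≈ 0h
    D2-+ : ∀ {C A B} {f : Hom A B} {h k v : Hom C A} →
           D f ∘ ⟨ h + k , v ⟩ ≈ D f ∘ ⟨ h , v ⟩ + D f ∘ ⟨ k , v ⟩
    D2-0 : ∀ {C A B} {f : Hom A B} {v : Hom C A} → D f ∘ ⟨ 0h , v ⟩ ≈ 0h
    D3-id : ∀ {A} → D (id {A}) ≈ π₁
    D3-π₁ : ∀ {A B} → D (π₁ {A} {B}) ≈ π₁ ∘ π₁
    D3-π₂ : ∀ {A B} → D (π₂ {A} {B}) ≈ π₂ ∘ π₁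
    D4 : ∀ {C A B} {f : Hom C A} {g : Hom C B} → D ⟨ f , g ⟩ ≈ ⟨ D f , D g ⟩
    D5 : ∀ {A B C} {f : Hom B C} {g : Hom A B} →
         D (f ∘ g) ≈ D f ∘ ⟨ D g , g ∘ π₂ ⟩
    D6 : ∀ {X A B} {f : Hom A B} {g h k : Hom X A} →
         D (D f) ∘ ⟨ ⟨ g , 0h ⟩ , ⟨ h , k ⟩ ⟩ ≈ D f ∘ ⟨ g , k ⟩
    D7 : ∀ {X A B} {f : Hom A B} {g h k : Hom X A} →
         D (D f) ∘ ⟨ ⟨ 0h , h ⟩ , ⟨ g , k ⟩ ⟩ ≈ D (D f) ∘ ⟨ ⟨ 0h , g ⟩ , ⟨ h , k ⟩ ⟩
    Λ-+ : ∀ {C A B} {f g : Hom (C ×ᶜ A) B} → Λ (f + g) ≈ Λ f + Λ g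
    Λ-0 : ∀ {C A B} → Λ (0h {C ×ᶜ A} {B}) ≈ 0h
    D-Λ : ∀ {C A B} {f : Hom (C ×ᶜ A) B} →
          D (Λ f) ≈ Λ (D f ∘ ⟨ π₁ ⁂ 0h {A} {A} , π₂ ⁂ id {A} ⟩)

  IsLinear : ∀ {A B} → Hom A B → Set e
  IsLinear f = D f ≈ f ∘ π₁

  _⋆_ : ∀ {C A B} → Hom (C ×ᶜ A) B → Hom C A → Hom (C ×ᶜ A) B
  f ⋆ g = D f ∘ ⟨ ⟨ 0h , g ∘ π₁ ⟩ , id ⟩

record LinearReflexive {o ℓ e} (𝒞 : Cat o ℓ e) (𝒟 : IsCCDC 𝒞) : Set (o ⊔ ℓ ⊔ e) where
  open Cat 𝒞
  open IsCCDC 𝒟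
  field
    U : Obj
    𝒜 : Hom U [ U ⇒ U ]
    lam : Hom [ U ⇒ U ] U
    𝒜-linear : IsLinear 𝒜
    lam-linear : IsLinear lam
    𝒜∘lam : 𝒜 ∘ lam ≈ id

IsExtensional : ∀ {o ℓ e} {𝒞 : Cat o ℓ e} {𝒟 : IsCCDC 𝒞} → LinearReflexive 𝒞 𝒟 → Set e
IsExtensional {𝒞 = 𝒞} R = lam ∘ 𝒜 ≈ id
  where open Cat 𝒞
        open LinearReflexive R

Var : Set
Var = ℕ

infixr 5 _⊕_
mutual
  data Simple : Set where
    var : Var → Simple
    ƛ   : Var → Simple → Simple
    app : Simple → Sum → Simple
    D·  : Simple → Simple → Simple
  data Sum : Set where
    0ₛ  : Sum
    _⊕_ : Simple → Sum → Sum

⌜_⌝ : Simple → Sum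
⌜ s ⌝ = s ⊕ 0ₛ

mutual
  data _∈FV_ (x : Var) : Simple → Set where
    fv-var  : x ∈FV var x
    fv-ƛ    : ∀ {y s} → ¬ (x ≡ y) → x ∈FV s → x ∈FV ƛ y s
    fv-app₁ : ∀ {s T} → x ∈FV s → x ∈FV app s T
    fv-app₂ : ∀ {s T} → x ∈FVₛ T → x ∈FV app s T
    fv-D₁   : ∀ {s t} → x ∈FV s → x ∈FV D· s t
    fv-D₂   : ∀ {s t} → x ∈FV t → x ∈FV D· s t
  data _∈FVₛ_ (x : Var) : Sum → Set where
    fv-here  : ∀ {s S} → x ∈FV s → x ∈FVₛ (s ⊕ S)
    fv-there : ∀ {s S} → x ∈FVₛ S → x ∈FVₛ (s ⊕ S)

-- a context x₁ … xₙ is represented as the list xₙ ∷ … ∷ x₁ ∷ []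
Ctx : Set
Ctx = List Var

module Semantics {o ℓ e} (𝒞 : Cat o ℓ e) (𝒟 : IsCCDC 𝒞) (R : LinearReflexive 𝒞 𝒟) where
  open Cat 𝒞
  open IsCCDC 𝒟
  open LinearReflexive R

  U^ : Ctx → Obj
  U^ []      = ⊤ᶜ
  U^ (_ ∷ Γ) = U^ Γ ×ᶜ U

  -- ⟦xᵢ⟧ = πᵢ  (the last occurrence in the context wins; the 0 case never
  -- arises for adequate contexts)
  lookupVar : (Γ : Ctx) → Var → Hom (U^ Γ) U
  lookupVar []      x = 0h
  lookupVar (y ∷ Γ) x with x ≟ y
  ... | yes _ = π₂
  ... | no  _ = lookupVar Γ x ∘ π₁

  mutual
    ⟦_⟧ : Simple → (Γ : Ctx) → Hom (U^ Γ) U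
    ⟦ var x   ⟧ Γ = lookupVar Γ x
    ⟦ ƛ z s   ⟧ Γ = lam ∘ Λ (⟦ s ⟧ (z ∷ Γ))
    ⟦ app s T ⟧ Γ = ev ∘ ⟨ 𝒜 ∘ ⟦ s ⟧ Γ , ⟦ T ⟧ₛ Γ ⟩
    ⟦ D· s t  ⟧ Γ = lam ∘ Λ (Λ⁻ (𝒜 ∘ ⟦ s ⟧ Γ) ⋆ ⟦ t ⟧ Γ)

    ⟦_⟧ₛ : Sum → (Γ : Ctx) → Hom (U^ Γ) U
    ⟦ 0ₛ    ⟧ₛ Γ = 0h
    ⟦ s ⊕ S ⟧ₛ Γ = ⟦ s ⟧ Γ + ⟦ S ⟧ₛ Γ

  Adequate : Ctx → Sum → Set
  Adequate Γ S = Unique Γ ∧ (∀ y → y ∈FVₛ S → y ∈ Γ)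

  _≐_∈Th : Sum → Sum → Set e
  S ≐ T ∈Th = ∃[ Γ ] (Adequate Γ S ∧ Adequate Γ T ∧ ⟦ S ⟧ₛ Γ ≈ ⟦ T ⟧ₛ Γ)

module Submission where

open import Defs
open import Level using (Level)
open import Relation.Nullary using (¬_)

open import Relation.Binary using (Setoid; IsEquivalence)
import Relation.Binary.Reasoning.Setoid as SetoidReasoning
open import Relation.Binary.PropositionalEquality using (refl)
open import Data.Nat using (ℕ; suc; _⊔_; _<_; _≟_)
open import Data.Nat.Properties using (m≤m⊔n; m≤n⊔m; <-≤-trans; ≤-refl)
open import Data.List using (_∷_; upTo)
open import Data.List.Membership.Propositional using (_∈_)
open import Data.List.Membership.Propositional.Properties using (∈-upTo⁺)
open import Data.List.Relation.Unary.Unique.Propositional.Properties using (upTo⁺)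
open import Data.Product using (_,_)
open import Relation.Nullary using (yes; no)
open import Data.Empty using (⊥-elim)

-- The interpretation is natural in the context: precomposing ⟦ s ⟧ Γ with a
-- context morphism that agrees with the variable projections on FV(s) yields ⟦ s ⟧ Δ
-- (naturality of Λ, Λ⁻ and ⋆ is what makes the λ- and D-cases go through). For x ∉ FV(s)
-- this gives ⟦ s x ⟧ (x ∷ Γ) = Λ⁻ (𝒜 ∘ ⟦ s ⟧ Γ), hence
-- ⟦ λx.sx ⟧ Γ = λ ∘ Λ (Λ⁻ (𝒜 ∘ ⟦ s ⟧ Γ)) = λ ∘ 𝒜 ∘ ⟦ s ⟧ Γ = ⟦ s ⟧ Γ.
-- Any list of distinct variables covering FV(s), such as 0 … n − 1, is an adequate context.

mutual
  varBound : Simple → ℕ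
  varBound (var x)   = suc x
  varBound (ƛ _ s)   = varBound s
  varBound (app s T) = varBound s ⊔ varBoundₛ T
  varBound (D· s t)  = varBound s ⊔ varBound t

  varBoundₛ : Sum → ℕ
  varBoundₛ 0ₛ      = 0
  varBoundₛ (s ⊕ S) = varBound s ⊔ varBoundₛ S

mutual
  ∈FV⇒<varBound : ∀ {y} s → y ∈FV s → y < varBound s
  ∈FV⇒<varBound (var x)   fv-var      = ≤-refl
  ∈FV⇒<varBound (ƛ _ s)   (fv-ƛ _ p)  = ∈FV⇒<varBound s p
  ∈FV⇒<varBound (app s T) (fv-app₁ p) = <-≤-trans (∈FV⇒<varBound s p) (m≤m⊔n _ _)
  ∈FV⇒<varBound (app s T) (fv-app₂ p) = <-≤-trans (∈FVₛ⇒<varBoundₛ T p) (m≤n⊔m _ _)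
  ∈FV⇒<varBound (D· s t)  (fv-D₁ p)   = <-≤-trans (∈FV⇒<varBound s p) (m≤m⊔n _ _)
  ∈FV⇒<varBound (D· s t)  (fv-D₂ p)   = <-≤-trans (∈FV⇒<varBound t p) (m≤n⊔m _ _)

  ∈FVₛ⇒<varBoundₛ : ∀ {y} S → y ∈FVₛ S → y < varBoundₛ S
  ∈FVₛ⇒<varBoundₛ (s ⊕ S) (fv-here p)  = <-≤-trans (∈FV⇒<varBound s p) (m≤m⊔n _ _)
  ∈FVₛ⇒<varBoundₛ (s ⊕ S) (fv-there p) = <-≤-trans (∈FVₛ⇒<varBoundₛ S p) (m≤n⊔m _ _)

∈FV⇒∈upTo-varBound : ∀ {y} s → y ∈FV s → y ∈ upTo (varBound s)
∈FV⇒∈upTo-varBound s p = ∈-upTo⁺ (∈FV⇒<varBound s p)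

∈FV-η-expansion : ∀ {x y s} → y ∈FVₛ ⌜ ƛ x (app s ⌜ var x ⌝) ⌝ → y ∈FV s
∈FV-η-expansion (fv-here (fv-ƛ _ (fv-app₁ p)))                     = p
∈FV-η-expansion (fv-here (fv-ƛ y≢x (fv-app₂ (fv-here fv-var))))    = ⊥-elim (y≢x refl)
∈FV-η-expansion (fv-here (fv-ƛ _ (fv-app₂ (fv-there ()))))
∈FV-η-expansion (fv-there ())

module CartesianLemmas {o ℓ e} (𝒞 : Cat o ℓ e) where
  open Cat 𝒞

  ≈-refl : ∀ {A B} {f : Hom A B} → f ≈ f
  ≈-refl = IsEquivalence.refl ≈-equiv

  ≈-sym : ∀ {A B} {f g : Hom A B} → f ≈ g → g ≈ f
  ≈-sym = IsEquivalence.sym ≈-equiv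

  ≈-trans : ∀ {A B} {f g h : Hom A B} → f ≈ g → g ≈ h → f ≈ h
  ≈-trans = IsEquivalence.trans ≈-equiv

  hom-setoid : Obj → Obj → Setoid ℓ e
  hom-setoid A B = record { Carrier = Hom A B ; _≈_ = _≈_ ; isEquivalence = ≈-equiv }

  module HomReasoning {A B : Obj} = SetoidReasoning (hom-setoid A B)

  ∘-resp-≈ˡ : ∀ {A B C} {f f′ : Hom B C} {g : Hom A B} → f ≈ f′ → f ∘ g ≈ f′ ∘ g
  ∘-resp-≈ˡ p = ∘-resp-≈ p ≈-refl

  ∘-resp-≈ʳ : ∀ {A B C} {f : Hom B C} {g g′ : Hom A B} → g ≈ g′ → f ∘ g ≈ f ∘ g′
  ∘-resp-≈ʳ p = ∘-resp-≈ ≈-refl p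

  pullˡ : ∀ {A B C D} {f : Hom C D} {g : Hom B C} {h : Hom A B} {k : Hom B D} →
          f ∘ g ≈ k → f ∘ (g ∘ h) ≈ k ∘ h
  pullˡ p = ≈-trans (≈-sym assoc) (∘-resp-≈ˡ p)

  extendʳ : ∀ {A B C D E} {f : Hom C D} {a : Hom B C} {b : Hom A B} {c : Hom E C} {d : Hom A E} →
            a ∘ b ≈ c ∘ d → (f ∘ a) ∘ b ≈ (f ∘ c) ∘ d
  extendʳ p = ≈-trans assoc (≈-trans (∘-resp-≈ʳ p) (≈-sym assoc))

  +-identityʳ : ∀ {A B} {f : Hom A B} → f + 0h ≈ f
  +-identityʳ = ≈-trans +-comm +-identityˡ

  ⟨⟩∘ : ∀ {X C A B} {f : Hom C A} {g : Hom C B} {h : Hom X C} →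
        ⟨ f , g ⟩ ∘ h ≈ ⟨ f ∘ h , g ∘ h ⟩
  ⟨⟩∘ = ≈-trans (≈-sym ×-η) (⟨⟩-resp-≈ (pullˡ π₁-β) (pullˡ π₂-β))

  ⁂∘⁂ : ∀ {A B C D E F} {a : Hom B C} {b : Hom E F} {c : Hom A B} {d : Hom D E} →
        (a ⁂ b) ∘ (c ⁂ d) ≈ (a ∘ c) ⁂ (b ∘ d)
  ⁂∘⁂ = ≈-trans ⟨⟩∘ (⟨⟩-resp-≈ (extendʳ π₁-β) (extendʳ π₂-β))

  ∘⁂id : ∀ {A B C D} {h : Hom B C} {w : Hom A B} →
         (h ∘ w) ⁂ id {D} ≈ (h ⁂ id) ∘ (w ⁂ id)
  ∘⁂id = ≈-trans (⟨⟩-resp-≈ ≈-refl (∘-resp-≈ˡ (≈-sym identityˡ))) (≈-sym ⁂∘⁂)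

module ClosedDifferentialLemmas {o ℓ e} (𝒞 : Cat o ℓ e) (𝒟 : IsCCDC 𝒞) where
  open Cat 𝒞
  open IsCCDC 𝒟
  open CartesianLemmas 𝒞 public
  open HomReasoning

  Λ-natural : ∀ {X C A B} {f : Hom (C ×ᶜ A) B} {w : Hom X C} →
              Λ f ∘ w ≈ Λ (f ∘ (w ⁂ id))
  Λ-natural {f = f} {w} = begin
    Λ f ∘ w                          ≈⟨ Λ-η ⟨
    Λ (ev ∘ ((Λ f ∘ w) ⁂ id))        ≈⟨ Λ-resp-≈ (∘-resp-≈ʳ ∘⁂id) ⟩
    Λ (ev ∘ ((Λ f ⁂ id) ∘ (w ⁂ id))) ≈⟨ Λ-resp-≈ (pullˡ Λ-β) ⟩
    Λ (f ∘ (w ⁂ id))                 ∎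

  Λ⁻-natural : ∀ {X C A B} {h : Hom C [ A ⇒ B ]} {w : Hom X C} →
               Λ⁻ (h ∘ w) ≈ Λ⁻ h ∘ (w ⁂ id)
  Λ⁻-natural = ≈-trans (∘-resp-≈ʳ ∘⁂id) (≈-sym assoc)

  Λ⁻-resp-≈ : ∀ {C A B} {h h′ : Hom C [ A ⇒ B ]} → h ≈ h′ → Λ⁻ h ≈ Λ⁻ h′
  Λ⁻-resp-≈ p = ∘-resp-≈ʳ (⟨⟩-resp-≈ (∘-resp-≈ˡ p) ≈-refl)

  ⋆-resp-≈ : ∀ {C A B} {f f′ : Hom (C ×ᶜ A) B} {g g′ : Hom C A} →
             f ≈ f′ → g ≈ g′ → f ⋆ g ≈ f′ ⋆ g′
  ⋆-resp-≈ p q = ∘-resp-≈ (D-resp-≈ p) (⟨⟩-resp-≈ (⟨⟩-resp-≈ ≈-refl (∘-resp-≈ˡ q)) ≈-refl)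

  D-∘π₁-vertical : ∀ {X C A B} {w : Hom C B} {k : Hom X A} {v : Hom X (C ×ᶜ A)} →
                   D (w ∘ π₁) ∘ ⟨ ⟨ 0h , k ⟩ , v ⟩ ≈ 0h
  D-∘π₁-vertical {w = w} {k} {v} = begin
    D (w ∘ π₁) ∘ ⟨ ⟨ 0h , k ⟩ , v ⟩                  ≈⟨ ∘-resp-≈ˡ D5 ⟩
    (D w ∘ ⟨ D π₁ , π₁ ∘ π₂ ⟩) ∘ ⟨ ⟨ 0h , k ⟩ , v ⟩   ≈⟨ ≈-trans assoc (∘-resp-≈ʳ ⟨⟩∘) ⟩
    D w ∘ ⟨ D π₁ ∘ ⟨ ⟨ 0h , k ⟩ , v ⟩ , (π₁ ∘ π₂) ∘ ⟨ ⟨ 0h , k ⟩ , v ⟩ ⟩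
      ≈⟨ ∘-resp-≈ʳ (⟨⟩-resp-≈ D-π₁-on-tangent ≈-refl) ⟩
    D w ∘ ⟨ 0h , (π₁ ∘ π₂) ∘ ⟨ ⟨ 0h , k ⟩ , v ⟩ ⟩   ≈⟨ D2-0 ⟩
    0h                                              ∎
    where
    D-π₁-on-tangent : D π₁ ∘ ⟨ ⟨ 0h , k ⟩ , v ⟩ ≈ 0h
    D-π₁-on-tangent = ≈-trans (∘-resp-≈ˡ D3-π₁) (≈-trans assoc (≈-trans (∘-resp-≈ʳ π₁-β) π₁-β))

  D-id∘π₂ : ∀ {X C A} {h : Hom X C} {k : Hom X A} {v : Hom X (C ×ᶜ A)} →
            D (id ∘ π₂) ∘ ⟨ ⟨ h , k ⟩ , v ⟩ ≈ k
  D-id∘π₂ {h = h} {k} {v} = begin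
    D (id ∘ π₂) ∘ ⟨ ⟨ h , k ⟩ , v ⟩                 ≈⟨ ∘-resp-≈ˡ (≈-trans D5 (∘-resp-≈ˡ D3-id)) ⟩
    (π₁ ∘ ⟨ D π₂ , π₂ ∘ π₂ ⟩) ∘ ⟨ ⟨ h , k ⟩ , v ⟩    ≈⟨ ∘-resp-≈ˡ π₁-β ⟩
    D π₂ ∘ ⟨ ⟨ h , k ⟩ , v ⟩                        ≈⟨ ∘-resp-≈ˡ D3-π₂ ⟩
    (π₂ ∘ π₁) ∘ ⟨ ⟨ h , k ⟩ , v ⟩                   ≈⟨ ≈-trans assoc (∘-resp-≈ʳ π₁-β) ⟩
    π₂ ∘ ⟨ h , k ⟩                                  ≈⟨ π₂-β ⟩
    k                                               ∎

  D-⁂id-vertical : ∀ {X C A B} {w : Hom C B} {k : Hom X A} {v : Hom X (C ×ᶜ A)} →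
                   D (w ⁂ id) ∘ ⟨ ⟨ 0h , k ⟩ , v ⟩ ≈ ⟨ 0h , k ⟩
  D-⁂id-vertical = ≈-trans (∘-resp-≈ˡ D4) (≈-trans ⟨⟩∘ (⟨⟩-resp-≈ D-∘π₁-vertical D-id∘π₂))

  ⋆-natural : ∀ {X C A B} {f : Hom (C ×ᶜ A) B} {g : Hom C A} {w : Hom X C} →
              (f ∘ (w ⁂ id)) ⋆ (g ∘ w) ≈ (f ⋆ g) ∘ (w ⁂ id)
  ⋆-natural {f = f} {g} {w} = begin
    D (f ∘ (w ⁂ id)) ∘ ⟨ ⟨ 0h , (g ∘ w) ∘ π₁ ⟩ , id ⟩
      ≈⟨ ≈-trans (∘-resp-≈ˡ D5) (≈-trans assoc (∘-resp-≈ʳ ⟨⟩∘)) ⟩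
    D f ∘ ⟨ D (w ⁂ id) ∘ ⟨ ⟨ 0h , (g ∘ w) ∘ π₁ ⟩ , id ⟩
          , ((w ⁂ id) ∘ π₂) ∘ ⟨ ⟨ 0h , (g ∘ w) ∘ π₁ ⟩ , id ⟩ ⟩
      ≈⟨ ∘-resp-≈ʳ (⟨⟩-resp-≈ D-⁂id-vertical (≈-trans assoc (≈-trans (∘-resp-≈ʳ π₂-β) identityʳ))) ⟩
    D f ∘ ⟨ ⟨ 0h , (g ∘ w) ∘ π₁ ⟩ , w ⁂ id ⟩
      ≈⟨ ∘-resp-≈ʳ (⟨⟩-resp-≈ tangent-natural (≈-sym identityˡ)) ⟩
    D f ∘ ⟨ ⟨ 0h , g ∘ π₁ ⟩ ∘ (w ⁂ id) , id ∘ (w ⁂ id) ⟩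
      ≈⟨ ≈-trans (∘-resp-≈ʳ (≈-sym ⟨⟩∘)) (≈-sym assoc) ⟩
    (D f ∘ ⟨ ⟨ 0h , g ∘ π₁ ⟩ , id ⟩) ∘ (w ⁂ id) ∎
    where
    tangent-natural : ⟨ 0h , (g ∘ w) ∘ π₁ ⟩ ≈ ⟨ 0h , g ∘ π₁ ⟩ ∘ (w ⁂ id)
    tangent-natural = ≈-sym (≈-trans ⟨⟩∘ (⟨⟩-resp-≈ 0-∘ (extendʳ π₁-β)))

module Interpretation {o ℓ e} (𝒞 : Cat o ℓ e) (𝒟 : IsCCDC 𝒞) (R : LinearReflexive 𝒞 𝒟) where
  open Cat 𝒞
  open IsCCDC 𝒟
  open LinearReflexive R
  open Semantics 𝒞 𝒟 R
  open ClosedDifferentialLemmas 𝒞 𝒟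
  open HomReasoning

  Reindexing : (Var → Set) → (Γ Δ : Ctx) → Hom (U^ Δ) (U^ Γ) → Set e
  Reindexing P Γ Δ w = ∀ {y} → P y → lookupVar Δ y ≈ lookupVar Γ y ∘ w

  Reindexing-ƛ : ∀ {z s Γ Δ w} → Reindexing (_∈FV ƛ z s) Γ Δ w →
                 Reindexing (_∈FV s) (z ∷ Γ) (z ∷ Δ) (w ⁂ id)
  Reindexing-ƛ {z} {s} {Γ} {Δ} {w} h {y} p with y ≟ z
  ... | yes _   = ≈-sym (≈-trans π₂-β identityˡ)
  ... | no  y≢z = begin
    lookupVar Δ y ∘ π₁               ≈⟨ ∘-resp-≈ˡ (h (fv-ƛ y≢z p)) ⟩
    (lookupVar Γ y ∘ w) ∘ π₁         ≈⟨ ≈-trans assoc (∘-resp-≈ʳ (≈-sym π₁-β)) ⟩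
    lookupVar Γ y ∘ (π₁ ∘ (w ⁂ id))  ≈⟨ assoc ⟨
    (lookupVar Γ y ∘ π₁) ∘ (w ⁂ id)  ∎

  Reindexing-π₁ : ∀ {s x Γ} → ¬ (x ∈FV s) → Reindexing (_∈FV s) Γ (x ∷ Γ) π₁
  Reindexing-π₁ {x = x} x∉s {y} p with y ≟ x
  ... | yes refl = ⊥-elim (x∉s p)
  ... | no  _    = ≈-refl

  mutual
    ⟦⟧-reindex : ∀ s {Γ Δ w} → Reindexing (_∈FV s) Γ Δ w → ⟦ s ⟧ Δ ≈ ⟦ s ⟧ Γ ∘ w
    ⟦⟧-reindex (var x) h = h fv-var
    ⟦⟧-reindex (ƛ z s) {Γ} {Δ} {w} h = begin
      lam ∘ Λ (⟦ s ⟧ (z ∷ Δ))            ≈⟨ ∘-resp-≈ʳ (Λ-resp-≈ (⟦⟧-reindex s (Reindexing-ƛ h))) ⟩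
      lam ∘ Λ (⟦ s ⟧ (z ∷ Γ) ∘ (w ⁂ id)) ≈⟨ ∘-resp-≈ʳ Λ-natural ⟨
      lam ∘ (Λ (⟦ s ⟧ (z ∷ Γ)) ∘ w)      ≈⟨ assoc ⟨
      (lam ∘ Λ (⟦ s ⟧ (z ∷ Γ))) ∘ w      ∎
    ⟦⟧-reindex (app s T) {Γ} {Δ} {w} h = begin
      ev ∘ ⟨ 𝒜 ∘ ⟦ s ⟧ Δ , ⟦ T ⟧ₛ Δ ⟩
        ≈⟨ ∘-resp-≈ʳ (⟨⟩-resp-≈ (∘-resp-≈ʳ (⟦⟧-reindex s (λ p → h (fv-app₁ p))))
                                (⟦⟧ₛ-reindex T (λ p → h (fv-app₂ p)))) ⟩
      ev ∘ ⟨ 𝒜 ∘ (⟦ s ⟧ Γ ∘ w) , ⟦ T ⟧ₛ Γ ∘ w ⟩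
        ≈⟨ ∘-resp-≈ʳ (≈-trans (⟨⟩-resp-≈ (≈-sym assoc) ≈-refl) (≈-sym ⟨⟩∘)) ⟩
      ev ∘ (⟨ 𝒜 ∘ ⟦ s ⟧ Γ , ⟦ T ⟧ₛ Γ ⟩ ∘ w) ≈⟨ assoc ⟨
      (ev ∘ ⟨ 𝒜 ∘ ⟦ s ⟧ Γ , ⟦ T ⟧ₛ Γ ⟩) ∘ w ∎
    ⟦⟧-reindex (D· s t) {Γ} {Δ} {w} h = begin
      lam ∘ Λ (Λ⁻ (𝒜 ∘ ⟦ s ⟧ Δ) ⋆ ⟦ t ⟧ Δ)
        ≈⟨ ∘-resp-≈ʳ (Λ-resp-≈ (⋆-resp-≈ (Λ⁻-resp-≈ 𝒜∘⟦s⟧-reindex)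
                                         (⟦⟧-reindex t (λ p → h (fv-D₂ p))))) ⟩
      lam ∘ Λ (Λ⁻ ((𝒜 ∘ ⟦ s ⟧ Γ) ∘ w) ⋆ (⟦ t ⟧ Γ ∘ w))
        ≈⟨ ∘-resp-≈ʳ (Λ-resp-≈ (≈-trans (⋆-resp-≈ Λ⁻-natural ≈-refl) ⋆-natural)) ⟩
      lam ∘ Λ ((Λ⁻ (𝒜 ∘ ⟦ s ⟧ Γ) ⋆ ⟦ t ⟧ Γ) ∘ (w ⁂ id)) ≈⟨ ∘-resp-≈ʳ Λ-natural ⟨
      lam ∘ (Λ (Λ⁻ (𝒜 ∘ ⟦ s ⟧ Γ) ⋆ ⟦ t ⟧ Γ) ∘ w)        ≈⟨ assoc ⟨
      (lam ∘ Λ (Λ⁻ (𝒜 ∘ ⟦ s ⟧ Γ) ⋆ ⟦ t ⟧ Γ)) ∘ w        ∎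
      where
      𝒜∘⟦s⟧-reindex : 𝒜 ∘ ⟦ s ⟧ Δ ≈ (𝒜 ∘ ⟦ s ⟧ Γ) ∘ w
      𝒜∘⟦s⟧-reindex = ≈-trans (∘-resp-≈ʳ (⟦⟧-reindex s (λ p → h (fv-D₁ p)))) (≈-sym assoc)

    ⟦⟧ₛ-reindex : ∀ S {Γ Δ w} → Reindexing (_∈FVₛ S) Γ Δ w → ⟦ S ⟧ₛ Δ ≈ ⟦ S ⟧ₛ Γ ∘ w
    ⟦⟧ₛ-reindex 0ₛ      h = ≈-sym 0-∘
    ⟦⟧ₛ-reindex (s ⊕ S) h =
      ≈-trans (+-resp-≈ (⟦⟧-reindex s (λ p → h (fv-here p))) (⟦⟧ₛ-reindex S (λ p → h (fv-there p))))
              (≈-sym +-∘)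

  lookupVar-head : ∀ x Γ → lookupVar (x ∷ Γ) x ≈ π₂
  lookupVar-head x Γ with x ≟ x
  ... | yes _   = ≈-refl
  ... | no  x≢x = ⊥-elim (x≢x refl)

  ⟦app-fresh-var⟧ : ∀ {s x Γ} → ¬ (x ∈FV s) →
                    ⟦ app s ⌜ var x ⌝ ⟧ (x ∷ Γ) ≈ Λ⁻ (𝒜 ∘ ⟦ s ⟧ Γ)
  ⟦app-fresh-var⟧ {s} {x} {Γ} x∉s = ∘-resp-≈ʳ (⟨⟩-resp-≈ 𝒜∘⟦s⟧-weaken ⟦x⟧-head)
    where
    𝒜∘⟦s⟧-weaken : 𝒜 ∘ ⟦ s ⟧ (x ∷ Γ) ≈ (𝒜 ∘ ⟦ s ⟧ Γ) ∘ π₁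
    𝒜∘⟦s⟧-weaken = ≈-trans (∘-resp-≈ʳ (⟦⟧-reindex s (Reindexing-π₁ x∉s))) (≈-sym assoc)
    ⟦x⟧-head : lookupVar (x ∷ Γ) x + 0h ≈ id ∘ π₂
    ⟦x⟧-head = ≈-trans +-identityʳ (≈-trans (lookupVar-head x Γ) (≈-sym identityˡ))

  lam∘Λ∘Λ⁻∘𝒜 : IsExtensional R → ∀ {X} (f : Hom X U) → lam ∘ Λ (Λ⁻ (𝒜 ∘ f)) ≈ f
  lam∘Λ∘Λ⁻∘𝒜 lam∘𝒜≈id f = begin
    lam ∘ Λ (Λ⁻ (𝒜 ∘ f)) ≈⟨ ∘-resp-≈ʳ Λ-η ⟩
    lam ∘ (𝒜 ∘ f)        ≈⟨ pullˡ lam∘𝒜≈id ⟩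
    id ∘ f               ≈⟨ identityˡ ⟩
    f                    ∎

  ⟦η-expansion⟧ : IsExtensional R → ∀ {s x} Γ → ¬ (x ∈FV s) →
                  ⟦ ⌜ ƛ x (app s ⌜ var x ⌝) ⌝ ⟧ₛ Γ ≈ ⟦ ⌜ s ⌝ ⟧ₛ Γ
  ⟦η-expansion⟧ extensional {s} Γ x∉s = +-resp-≈
    (≈-trans (∘-resp-≈ʳ (Λ-resp-≈ (⟦app-fresh-var⟧ x∉s))) (lam∘Λ∘Λ⁻∘𝒜 extensional (⟦ s ⟧ Γ)))
    ≈-refl

proposition4p12 : ∀ {o ℓ e} (𝒞 : Cat o ℓ e) (𝒟 : IsCCDC 𝒞) (R : LinearReflexive 𝒞 𝒟) →
    IsExtensional R →
    ∀ (s : Simple) (x : Var) → ¬ (x ∈FV s) →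
    Semantics._≐_∈Th 𝒞 𝒟 R ⌜ ƛ x (app s ⌜ var x ⌝) ⌝ ⌜ s ⌝
proposition4p12 𝒞 𝒟 R extensional s x x∉s =
  upTo (varBound s) ,
  (upTo⁺ (varBound s) , λ _ p → ∈FV⇒∈upTo-varBound s (∈FV-η-expansion p)) ,
  (upTo⁺ (varBound s) , λ { _ (fv-here p) → ∈FV⇒∈upTo-varBound s p }) ,
  Interpretation.⟦η-expansion⟧ 𝒞 𝒟 R extensional (upTo (varBound s)) x∉s
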